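{- For $n\ge2$ let $\Pi_n^*(14/23)$ be the set of set partitions of $[n]$ avoiding $14/23$ and having no singleton blocks. Define sets $\Pi_n^*$ recursively: $\Pi_2^*=\{\{\{1,2\}\}\}$, and for $n\ge3$, $\Pi_n^*$ is the set of all partitions obtained by either of the following operations: ($n$-insertion) take $\pi\in\Pi_{n-1}^*$ and insert $n$ into the block containing $n-1$; ($n$-augmentation, only for $n\ge4$) take $\sigma\in\Pi_{n-2}^*$, choose $k$ to be either a cap of $\sigma$ or $k=n-1$, increase by $1$ every value of $\sigma$ that is $\ge k$, and add the block $\{k,n\}$. Here, for a partition $\pi$ of $[m]$, an integer $k$ is a cap of $\pi$ if every $i$ with $k\le i\le m$ is the maximum element of its block. Then $\Pi_n^*=\Pi_n^*(14/23)$ for all $n\ge2$.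
   Context: The standardization of a set partition of a finite set $S\subset\mathbb{Z}_{>0}$ replaces the $i$-th smallest element of $S$ by $i$. A set partition $\pi$ of $[n]$ contains $\tau\vdash[k]$ if for some $S\subseteq[n]$ the standardization of the restriction of $\pi$ to $S$ is $\tau$; otherwise it avoids $\tau$. $14/23$ is the partition of $[4]$ with blocks $\{1,4\},\{2,3\}$. -}

module Defs where

open import Data.Nat using (ℕ; zero; suc; _+_; _∸_; _≤_; _<_; _≤ᵇ_; _<ᵇ_; _≡ᵇ_)
open import Data.Bool using (Bool; true; false; if_then_else_; _∧_; _∨_)
open import Data.Product using (Σ; _×_; ∃; ∃-syntax)
open import Data.Sum using (_⊎_)
open import Relation.Binary.PropositionalEquality using (_≡_; _≢_)
open import Relation.Nullary using (¬_)

-- Elements of [n] are the naturals 1..n.  A (candidate) set partition of [n]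
-- is encoded by its "same block" relation, a Bool-valued relation on ℕ of
-- which only the values on [n] × [n] matter.
BRel : Set
BRel = ℕ → ℕ → Bool

InRange : ℕ → ℕ → Set
InRange n i = (1 ≤ i) × (i ≤ n)

IsPartition : ℕ → BRel → Set
IsPartition n R =
  (∀ i → InRange n i → R i i ≡ true) ×
  (∀ i j → InRange n i → InRange n j → R i j ≡ R j i) ×
  (∀ i j l → InRange n i → InRange n j → InRange n l →
     R i j ≡ true → R j l ≡ true → R i l ≡ true)

_≐[_]_ : BRel → ℕ → BRel → Set
R ≐[ n ] S = ∀ i j → InRange n i → InRange n j → R i j ≡ S i j

-- Pattern containment: π (a partition of [n]) contains τ (a partition of [k])
-- iff there is S ⊆ [n] (given by the increasing enumeration f : [k] → [n] of S)
-- such that the standardization of π restricted to S equals τ.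
Contains : ℕ → BRel → ℕ → BRel → Set
Contains n π k τ =
  Σ (ℕ → ℕ) λ f →
    (∀ i → InRange k i → InRange n (f i)) ×
    (∀ i j → InRange k i → InRange k j → i < j → f i < f j) ×
    (∀ i j → InRange k i → InRange k j → π (f i) (f j) ≡ τ i j)

Avoids : ℕ → BRel → ℕ → BRel → Set
Avoids n π k τ = ¬ Contains n π k τ

label-14/23 : ℕ → ℕ
label-14/23 2 = 1
label-14/23 3 = 1
label-14/23 _ = 0

p14/23 : BRel
p14/23 i j = label-14/23 i ≡ᵇ label-14/23 j

NoSingletons : ℕ → BRel → Set
NoSingletons n R = ∀ i → InRange n i → ∃[ j ] (InRange n j × j ≢ i × R i j ≡ true)

InAvoidStar : ℕ → BRel → Set
InAvoidStar n R = IsPartition n R × Avoids n R 4 p14/23 × NoSingletons n R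

IsCap : ℕ → BRel → ℕ → Set
IsCap m σ k = ∀ i j → k ≤ i → i ≤ m → i < j → j ≤ m → σ i j ≡ false

-- n-insertion: π ⊢ [n-1] ↦ partition of [n] with n put in the block of n-1.
-- (Realised by identifying n with n-1.)
insertion : ℕ → BRel → BRel
insertion n π i j = π (clamp i) (clamp j)
  where
  clamp : ℕ → ℕ
  clamp x = if x ≤ᵇ (n ∸ 1) then x else n ∸ 1

-- n-augmentation: σ ⊢ [n-2], k; values ≥ k of σ are increased by 1 and the
-- block {k, n} is added.  An element a ∉ {k,n} of [n] comes from
-- unshift a = (a if a < k, a-1 otherwise) in σ.
augmentation : ℕ → ℕ → BRel → BRel
augmentation n k σ a b =
  if isNew a ∧ isNew b then true
  else if isNew a ∨ isNew b then false
  else σ (unshift a) (unshift b)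
  where
  isNew : ℕ → Bool
  isNew x = (x ≡ᵇ k) ∨ (x ≡ᵇ n)
  unshift : ℕ → ℕ
  unshift x = if x <ᵇ k then x else x ∸ 1

data Star : ℕ → BRel → Set where
  base : Star 2 (λ _ _ → true)
  ins  : ∀ {m π} → Star (suc m) π →
         Star (suc (suc m)) (insertion (suc (suc m)) π)
  aug  : ∀ {m σ} k → Star m σ → 2 ≤ m →
         ((1 ≤ k × k ≤ m × IsCap m σ k) ⊎ (k ≡ suc m)) →
         Star (suc (suc m)) (augmentation (suc (suc m)) k σ)

InStar : ℕ → BRel → Set
InStar n R = ∃[ S ] (Star n S × R ≐[ n ] S)

-- An occurrence of 14/23 in a partition is the same thing as a nesting:
-- a < b < c < d with a, d in one block and b, c in another.  Insertion and
-- augmentation create no nesting and no singleton: n joins n-1, and an arc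
-- b < c under the new block {k, n} would lie to the right of k, which a cap
-- (or k = n-1) forbids.  Conversely, let k be the largest partner of n.  If
-- the block of n has a further element a < k, then k = n-1, since a partner j
-- of n-1 outside the block of n would be nested with a, k or n wherever it
-- lies; then deleting n undoes an n-insertion.  Otherwise the block of n is
-- {k, n}, deleting it undoes an n-augmentation, and k is a cap because an arc
-- to its right would be nested under {k, n}.
module Submission where

open import Defs
open import Data.Bool using (Bool; true; false; if_then_else_; _∧_; _∨_)
open import Data.Bool.Properties using (T-≡; ¬-not; not-¬; ∨-zeroʳ)
open import Data.Empty using (⊥; ⊥-elim)
open import Data.Nat using (ℕ; zero; suc; _∸_; _≤_; _<_; _<ᵇ_; _≤ᵇ_; _≡ᵇ_; z≤n; s≤s; _≟_)
open import Data.Nat.Properties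
open import Data.Product using (_×_; _,_; proj₁; proj₂; uncurry)
open import Data.Sum using (_⊎_; inj₁; inj₂)
open import Function.Base using (_on_; _∘_)
open import Function.Bundles using (_⇔_; mk⇔; Equivalence)
open import Relation.Binary.PropositionalEquality
open import Relation.Nullary using (¬_; yes; no; contradiction)
open import Relation.Nullary.Reflects using (ofʸ; ofⁿ)
open import Relation.Binary.Definitions using (Tri; tri<; tri≈; tri>)

≡⇒≡ᵇ≡true : ∀ {m n} → m ≡ n → (m ≡ᵇ n) ≡ true
≡⇒≡ᵇ≡true {m} {n} m≡n = Equivalence.to T-≡ (≡⇒≡ᵇ m n m≡n)

≢⇒≡ᵇ≡false : ∀ {m n} → m ≢ n → (m ≡ᵇ n) ≡ false
≢⇒≡ᵇ≡false {m} {n} m≢n = ¬-not (λ m≡ᵇn → m≢n (≡ᵇ⇒≡ m n (Equivalence.from T-≡ m≡ᵇn)))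

≢true⇒≡false : ∀ {b} → b ≢ true → b ≡ false
≢true⇒≡false = ¬-not

Bool-ext : ∀ {p q : Bool} → (p ≡ true → q ≡ true) → (q ≡ true → p ≡ true) → p ≡ q
Bool-ext {true}  p⇒q _ = sym (p⇒q refl)
Bool-ext {false} {true} _ q⇒p = q⇒p refl
Bool-ext {false} {false} _ _ = refl

InRange-≤ : ∀ {m n i} → m ≤ n → InRange m i → InRange n i
InRange-≤ m≤n (1≤i , i≤m) = 1≤i , ≤-trans i≤m m≤n

module Partition {n : ℕ} {R : BRel} (P : IsPartition n R) where

  ~-refl : ∀ {i} → InRange n i → R i i ≡ true
  ~-refl = proj₁ P _

  R-sym : ∀ {i j} → InRange n i → InRange n j → R i j ≡ R j i
  R-sym = proj₁ (proj₂ P) _ _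

  ~-sym : ∀ {i j} → InRange n i → InRange n j → R i j ≡ true → R j i ≡ true
  ~-sym i∈ j∈ i~j = trans (R-sym j∈ i∈) i~j

  ≁-sym : ∀ {i j} → InRange n i → InRange n j → R i j ≡ false → R j i ≡ false
  ≁-sym i∈ j∈ i≁j = trans (R-sym j∈ i∈) i≁j

  ~-trans : ∀ {i j l} → InRange n i → InRange n j → InRange n l →
            R i j ≡ true → R j l ≡ true → R i l ≡ true
  ~-trans = proj₂ (proj₂ P) _ _ _

  ≁-~-trans : ∀ {i j l} → InRange n i → InRange n j → InRange n l →
              R i j ≡ false → R j l ≡ true → R i l ≡ false
  ≁-~-trans i∈ j∈ l∈ i≁j j~l =
    ≢true⇒≡false λ i~l → not-¬ (~-trans i∈ l∈ j∈ i~l (~-sym j∈ l∈ j~l)) i≁j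

  ~-≁-trans : ∀ {i j l} → InRange n i → InRange n j → InRange n l →
              R i j ≡ true → R j l ≡ false → R i l ≡ false
  ~-≁-trans i∈ j∈ l∈ i~j j≁l =
    ≁-sym l∈ i∈ (≁-~-trans l∈ j∈ i∈ (≁-sym j∈ l∈ j≁l) (~-sym i∈ j∈ i~j))

  R-resp-~ : ∀ {i i′ j j′} → InRange n i → InRange n i′ → InRange n j → InRange n j′ →
           R i i′ ≡ true → R j j′ ≡ true → R i j ≡ R i′ j′
  R-resp-~ i∈ i′∈ j∈ j′∈ i~i′ j~j′ = Bool-ext
    (λ i~j → ~-trans i′∈ i∈ j′∈ (~-sym i∈ i′∈ i~i′) (~-trans i∈ j∈ j′∈ i~j j~j′))
    (λ i′~j′ → ~-trans i∈ i′∈ j∈ i~i′ (~-trans i′∈ j′∈ j∈ i′~j′ (~-sym j∈ j′∈ j~j′)))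

IsPartition-on : ∀ {m n R} f → (∀ {i} → InRange m i → InRange n (f i)) →
                 IsPartition n R → IsPartition m (R on f)
IsPartition-on f f∈ (rfl , sym′ , trans′) =
  (λ i i∈ → rfl _ (f∈ i∈)) ,
  (λ i j i∈ j∈ → sym′ _ _ (f∈ i∈) (f∈ j∈)) ,
  (λ i j l i∈ j∈ l∈ → trans′ _ _ _ (f∈ i∈) (f∈ j∈) (f∈ l∈))

record Nesting (n : ℕ) (R : BRel) : Set where
  constructor nesting
  field
    {a b c d} : ℕ
    1≤a : 1 ≤ a
    a<b : a < b
    b<c : b < c
    c<d : c < d
    d≤n : d ≤ n
    a~d : R a d ≡ true
    b~c : R b c ≡ true
    a≁b : R a b ≡ false

  c<n : c < n
  c<n = <-≤-trans c<d d≤n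

  b<n : b < n
  b<n = <-trans b<c c<n

  a<n : a < n
  a<n = <-trans a<b b<n

  a∈ : InRange n a
  a∈ = 1≤a , <⇒≤ a<n

  b∈ : InRange n b
  b∈ = ≤-trans 1≤a (<⇒≤ a<b) , <⇒≤ b<n

  c∈ : InRange n c
  c∈ = ≤-trans 1≤a (<⇒≤ (<-trans a<b b<c)) , <⇒≤ c<n

  d∈ : InRange n d
  d∈ = ≤-trans 1≤a (<⇒≤ (<-trans a<b (<-trans b<c c<d))) , d≤n

Nesting-on : ∀ {m n R} f → (∀ {i} → InRange m i → InRange n (f i)) →
             (∀ {i j} → i < j → f i < f j) → Nesting m (R on f) → Nesting n R
Nesting-on f f∈ f-mono ν =
  nesting (proj₁ (f∈ a∈)) (f-mono a<b) (f-mono b<c) (f-mono c<d) (proj₂ (f∈ d∈)) a~d b~c a≁b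
  where open Nesting ν

<-from-steps : ∀ {f : ℕ → ℕ} {n} → (∀ {i} → 1 ≤ i → suc i ≤ n → f i < f (suc i)) →
               ∀ {i j} → 1 ≤ i → i < j → j ≤ n → f i < f j
<-from-steps step {i} {suc j} 1≤i i<1+j 1+j≤n with m≤n⇒m<n∨m≡n (≤-pred i<1+j)
... | inj₁ i<j = <-trans (<-from-steps step 1≤i i<j (<⇒≤ 1+j≤n)) (step (≤-trans 1≤i (<⇒≤ i<j)) 1+j≤n)
... | inj₂ refl = step 1≤i 1+j≤n

data Index4 : ℕ → Set where
  #1 : Index4 1
  #2 : Index4 2
  #3 : Index4 3
  #4 : Index4 4

index4 : ∀ {i} → InRange 4 i → Index4 i
index4 {1} _ = #1
index4 {2} _ = #2
index4 {3} _ = #3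
index4 {4} _ = #4
index4 {0} (() , _)
index4 {suc (suc (suc (suc (suc _))))} (_ , s≤s (s≤s (s≤s (s≤s ()))))

quadruple : ℕ → ℕ → ℕ → ℕ → ℕ → ℕ
quadruple a b c d 1 = a
quadruple a b c d 2 = b
quadruple a b c d 3 = c
quadruple a b c d _ = d

Nesting⇒Contains-14/23 : ∀ {n R} → IsPartition n R → Nesting n R → Contains n R 4 p14/23
Nesting⇒Contains-14/23 {n} {R} P ν =
  f , f∈ , (λ i j i∈ j∈ i<j → f-mono (proj₁ i∈) i<j (proj₂ j∈)) , f-values
  where
  open Nesting ν
  open Partition P
  f : ℕ → ℕ
  f = quadruple a b c d

  f∈ : ∀ i → InRange 4 i → InRange n (f i)
  f∈ i i∈ with index4 i∈
  ... | #1 = a∈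
  ... | #2 = b∈
  ... | #3 = c∈
  ... | #4 = d∈

  f-step : ∀ {i} → 1 ≤ i → suc i ≤ 4 → f i < f (suc i)
  f-step {1} _ _ = a<b
  f-step {2} _ _ = b<c
  f-step {3} _ _ = c<d
  f-step {suc (suc (suc (suc _)))} _ (s≤s (s≤s (s≤s (s≤s ()))))

  f-mono : ∀ {i j} → 1 ≤ i → i < j → j ≤ 4 → f i < f j
  f-mono = <-from-steps f-step

  a≁c : R a c ≡ false
  a≁c = ≁-~-trans a∈ b∈ c∈ a≁b b~c
  b≁d : R b d ≡ false
  b≁d = ≁-~-trans b∈ a∈ d∈ (≁-sym a∈ b∈ a≁b) a~d
  c≁d : R c d ≡ false
  c≁d = ≁-sym d∈ c∈ (~-≁-trans d∈ a∈ c∈ (~-sym a∈ d∈ a~d) a≁c)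

  f-values : ∀ i j → InRange 4 i → InRange 4 j → R (f i) (f j) ≡ p14/23 i j
  f-values i j i∈ j∈ with index4 i∈ | index4 j∈
  ... | #1 | #1 = ~-refl a∈
  ... | #1 | #2 = a≁b
  ... | #1 | #3 = a≁c
  ... | #1 | #4 = a~d
  ... | #2 | #1 = ≁-sym a∈ b∈ a≁b
  ... | #2 | #2 = ~-refl b∈
  ... | #2 | #3 = b~c
  ... | #2 | #4 = b≁d
  ... | #3 | #1 = ≁-sym a∈ c∈ a≁c
  ... | #3 | #2 = ~-sym b∈ c∈ b~c
  ... | #3 | #3 = ~-refl c∈
  ... | #3 | #4 = c≁d
  ... | #4 | #1 = ~-sym a∈ d∈ a~d
  ... | #4 | #2 = ≁-sym b∈ d∈ b≁d
  ... | #4 | #3 = ≁-sym c∈ d∈ c≁d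
  ... | #4 | #4 = ~-refl d∈

Contains-14/23⇒Nesting : ∀ {n R} → Contains n R 4 p14/23 → Nesting n R
Contains-14/23⇒Nesting (f , f∈ , f-mono , f-values) =
  nesting (proj₁ (f∈ 1 1∈)) (f-mono 1 2 1∈ 2∈ ≤-refl) (f-mono 2 3 2∈ 3∈ ≤-refl)
          (f-mono 3 4 3∈ 4∈ ≤-refl) (proj₂ (f∈ 4 4∈))
          (f-values 1 4 1∈ 4∈) (f-values 2 3 2∈ 3∈) (f-values 1 2 1∈ 2∈)
  where
  1∈ : InRange 4 1
  1∈ = s≤s z≤n , s≤s z≤n
  2∈ : InRange 4 2
  2∈ = s≤s z≤n , s≤s (s≤s z≤n)
  3∈ : InRange 4 3
  3∈ = s≤s z≤n , s≤s (s≤s (s≤s z≤n))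
  4∈ : InRange 4 4
  4∈ = s≤s z≤n , ≤-refl

NestFree : ℕ → BRel → Set
NestFree n R = IsPartition n R × ¬ Nesting n R × NoSingletons n R

NestFree⇔InAvoidStar : ∀ {n R} → NestFree n R ⇔ InAvoidStar n R
NestFree⇔InAvoidStar = mk⇔
  (λ (P , ¬ν , ns) → P , (λ c → ¬ν (Contains-14/23⇒Nesting c)) , ns)
  (λ (P , ¬c , ns) → P , (λ ν → ¬c (Nesting⇒Contains-14/23 P ν)) , ns)

≐-sym : ∀ {n R S} → R ≐[ n ] S → S ≐[ n ] R
≐-sym R≐S i j i∈ j∈ = sym (R≐S i j i∈ j∈)

≐-trans : ∀ {n R S T} → R ≐[ n ] S → S ≐[ n ] T → R ≐[ n ] T
≐-trans R≐S S≐T i j i∈ j∈ = trans (R≐S i j i∈ j∈) (S≐T i j i∈ j∈)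

NestFree-resp-≐ : ∀ {n R S} → R ≐[ n ] S → NestFree n S → NestFree n R
NestFree-resp-≐ {n} {R} {S} R≐S ((rfl , sym′ , trans′) , ¬ν , ns) = P , ¬ν ∘ transport , ns′
  where
  P : IsPartition n R
  P = (λ i i∈ → trans (R≐S i i i∈ i∈) (rfl i i∈)) ,
      (λ i j i∈ j∈ → trans (R≐S i j i∈ j∈) (trans (sym′ i j i∈ j∈) (sym (R≐S j i j∈ i∈)))) ,
      (λ i j l i∈ j∈ l∈ i~j j~l → trans (R≐S i l i∈ l∈)
          (trans′ i j l i∈ j∈ l∈ (trans (sym (R≐S i j i∈ j∈)) i~j) (trans (sym (R≐S j l j∈ l∈)) j~l)))
  transport : Nesting n R → Nesting n S
  transport ν = nesting 1≤a a<b b<c c<d d≤n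
    (trans (sym (R≐S _ _ a∈ d∈)) a~d) (trans (sym (R≐S _ _ b∈ c∈)) b~c)
    (trans (sym (R≐S _ _ a∈ b∈)) a≁b)
    where open Nesting ν
  ns′ : NoSingletons n R
  ns′ i i∈ with ns i i∈
  ... | j , j∈ , j≢i , i~j = j , j∈ , j≢i , trans (R≐S i j i∈ j∈) i~j

InStar-resp-≐ : ∀ {n R S} → R ≐[ n ] S → InStar n S → InStar n R
InStar-resp-≐ R≐S (T , star , S≐T) = T , star , ≐-trans R≐S S≐T

module Insertion (m : ℕ) where

  N : ℕ
  N = suc (suc m)

  clamp : ℕ → ℕ
  clamp x = if x ≤ᵇ suc m then x else suc m

  clamp-≤ : ∀ {x} → x ≤ suc m → clamp x ≡ x
  clamp-≤ {x} x≤ with x ≤ᵇ suc m | ≤ᵇ-reflects-≤ x (suc m)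
  ... | true  | _ = refl
  ... | false | ofⁿ x≰ = contradiction x≤ x≰

  clamp-N : clamp N ≡ suc m
  clamp-N with N ≤ᵇ suc m | ≤ᵇ-reflects-≤ N (suc m)
  ... | true  | ofʸ N≤ = contradiction N≤ (<⇒≱ ≤-refl)
  ... | false | _ = refl

  clamp∈ : ∀ {x} → InRange N x → InRange (suc m) (clamp x)
  clamp∈ {x} (1≤x , x≤N) with m≤n⇒m<n∨m≡n x≤N
  ... | inj₁ x<N = subst (InRange (suc m)) (sym (clamp-≤ (≤-pred x<N))) (1≤x , ≤-pred x<N)
  ... | inj₂ refl = subst (InRange (suc m)) (sym clamp-N) (s≤s z≤n , ≤-refl)

  insertion-≤ : ∀ π {x y} → x ≤ suc m → y ≤ suc m → insertion N π x y ≡ π x y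
  insertion-≤ π x≤ y≤ = cong₂ π (clamp-≤ x≤) (clamp-≤ y≤)

  insertion-resp-≐ : ∀ {π S} → π ≐[ suc m ] S → insertion N π ≐[ N ] insertion N S
  insertion-resp-≐ π≐S i j i∈ j∈ = π≐S (clamp i) (clamp j) (clamp∈ i∈) (clamp∈ j∈)

  ¬Nesting-insertion : ∀ {π} → IsPartition (suc m) π → ¬ Nesting (suc m) π → ¬ Nesting N (insertion N π)
  ¬Nesting-insertion {π} P ¬ν ν = split (m≤n⇒m<n∨m≡n c≤) (m≤n⇒m<n∨m≡n d≤n)
    where
    open Nesting ν
    open Partition P
    c≤ : c ≤ suc m
    c≤ = ≤-pred c<n
    b≤ : b ≤ suc m
    b≤ = <⇒≤ (<-≤-trans b<c c≤)
    a≤ : a ≤ suc m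
    a≤ = <⇒≤ (<-≤-trans a<b b≤)
    b~c′ : π b c ≡ true
    b~c′ = trans (sym (insertion-≤ π b≤ c≤)) b~c
    a≁b′ : π a b ≡ false
    a≁b′ = trans (sym (insertion-≤ π a≤ b≤)) a≁b
    a~1+m : d ≡ N → π a (suc m) ≡ true
    a~1+m d≡N = trans (sym (cong₂ π (clamp-≤ a≤) clamp-N)) (subst (λ x → insertion N π a x ≡ true) d≡N a~d)
    split : c < suc m ⊎ c ≡ suc m → d < N ⊎ d ≡ N → ⊥
    split _ (inj₁ d<N) =
      ¬ν (nesting 1≤a a<b b<c c<d (≤-pred d<N)
                  (trans (sym (insertion-≤ π a≤ (≤-pred d<N))) a~d) b~c′ a≁b′)
    split (inj₁ c<1+m) (inj₂ d≡N) = ¬ν (nesting 1≤a a<b b<c c<1+m ≤-refl (a~1+m d≡N) b~c′ a≁b′)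
    split (inj₂ c≡1+m) (inj₂ d≡N) =
      not-¬ (~-trans a∈′ 1+m∈ b∈′ (a~1+m d≡N)
                     (~-sym b∈′ 1+m∈ (subst (λ x → π b x ≡ true) c≡1+m b~c′))) a≁b′
      where
      a∈′ : InRange (suc m) a
      a∈′ = 1≤a , a≤
      b∈′ : InRange (suc m) b
      b∈′ = ≤-trans 1≤a (<⇒≤ a<b) , b≤
      1+m∈ : InRange (suc m) (suc m)
      1+m∈ = s≤s z≤n , ≤-refl

  insertion-NestFree : ∀ {π} → NestFree (suc m) π → NestFree N (insertion N π)
  insertion-NestFree {π} (P , ¬ν , ns) = IsPartition-on clamp clamp∈ P , ¬Nesting-insertion P ¬ν , ns′
    where
    ns′ : NoSingletons N (insertion N π)
    ns′ i (1≤i , i≤N) with m≤n⇒m<n∨m≡n i≤N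
    ... | inj₁ i<N with ns i (1≤i , ≤-pred i<N)
    ...   | j , (1≤j , j≤) , j≢i , i~j =
      j , (1≤j , m≤n⇒m≤1+n j≤) , j≢i , trans (insertion-≤ π (≤-pred i<N) j≤) i~j
    ns′ i _ | inj₂ refl =
      suc m , (s≤s z≤n , n≤1+n _) , <⇒≢ ≤-refl ,
      trans (cong₂ π clamp-N (clamp-≤ ≤-refl)) (Partition.~-refl P (s≤s z≤n , ≤-refl))

AugmentationPoint : ℕ → BRel → ℕ → Set
AugmentationPoint m σ k = (1 ≤ k × k ≤ m × IsCap m σ k) ⊎ (k ≡ suc m)

module Augmentation (m k : ℕ) (1≤k : 1 ≤ k) (k≤1+m : k ≤ suc m) where

  N : ℕ
  N = suc (suc m)

  shift : ℕ → ℕ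
  shift x = if x <ᵇ k then x else suc x

  unshift : ℕ → ℕ
  unshift x = if x <ᵇ k then x else x ∸ 1

  shift-< : ∀ {x} → x < k → shift x ≡ x
  shift-< {x} x<k with x <ᵇ k | <ᵇ-reflects-< x k
  ... | true  | _ = refl
  ... | false | ofⁿ x≮k = contradiction x<k x≮k

  shift-≥ : ∀ {x} → k ≤ x → shift x ≡ suc x
  shift-≥ {x} k≤x with x <ᵇ k | <ᵇ-reflects-< x k
  ... | true  | ofʸ x<k = contradiction k≤x (<⇒≱ x<k)
  ... | false | _ = refl

  unshift-< : ∀ {x} → x < k → unshift x ≡ x
  unshift-< {x} x<k with x <ᵇ k | <ᵇ-reflects-< x k
  ... | true  | _ = refl
  ... | false | ofⁿ x≮k = contradiction x<k x≮k

  unshift-≥ : ∀ {x} → k ≤ x → unshift x ≡ x ∸ 1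
  unshift-≥ {x} k≤x with x <ᵇ k | <ᵇ-reflects-< x k
  ... | true  | ofʸ x<k = contradiction k≤x (<⇒≱ x<k)
  ... | false | _ = refl

  unshift-shift : ∀ y → unshift (shift y) ≡ y
  unshift-shift y with <-≤-connex y k
  ... | inj₁ y<k = trans (cong unshift (shift-< y<k)) (unshift-< y<k)
  ... | inj₂ k≤y = trans (cong unshift (shift-≥ k≤y)) (unshift-≥ (m≤n⇒m≤1+n k≤y))

  shift-injective : ∀ {y y′} → shift y ≡ shift y′ → y ≡ y′
  shift-injective {y} {y′} eq = trans (sym (unshift-shift y)) (trans (cong unshift eq) (unshift-shift y′))

  shift-mono-≤ : ∀ {x y} → x ≤ y → shift x ≤ shift y
  shift-mono-≤ {x} {y} x≤y with <-≤-connex x k | <-≤-connex y k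
  ... | inj₁ x<k | inj₁ y<k = subst₂ _≤_ (sym (shift-< x<k)) (sym (shift-< y<k)) x≤y
  ... | inj₁ x<k | inj₂ k≤y = subst₂ _≤_ (sym (shift-< x<k)) (sym (shift-≥ k≤y)) (m≤n⇒m≤1+n x≤y)
  ... | inj₂ k≤x | inj₁ y<k = contradiction (≤-trans k≤x x≤y) (<⇒≱ y<k)
  ... | inj₂ k≤x | inj₂ k≤y = subst₂ _≤_ (sym (shift-≥ k≤x)) (sym (shift-≥ k≤y)) (s≤s x≤y)

  shift-mono-< : ∀ {x y} → x < y → shift x < shift y
  shift-mono-< {x} {y} x<y =
    ≤∧≢⇒< (shift-mono-≤ (<⇒≤ x<y)) (λ eq → <-irrefl (shift-injective eq) x<y)

  shift-cancel-< : ∀ {x y} → shift x < shift y → x < y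
  shift-cancel-< {x} {y} sx<sy = ≰⇒> (λ y≤x → <⇒≱ sx<sy (shift-mono-≤ y≤x))

  k<shift⇒k≤ : ∀ {y} → k < shift y → k ≤ y
  k<shift⇒k≤ {y} k<sy with <-≤-connex y k
  ... | inj₁ y<k = contradiction (subst (k <_) (shift-< y<k) k<sy) (<-asym y<k)
  ... | inj₂ k≤y = k≤y

  shift-≤-suc : ∀ x → shift x ≤ suc x
  shift-≤-suc x with <-≤-connex x k
  ... | inj₁ x<k = subst (_≤ suc x) (sym (shift-< x<k)) (n≤1+n x)
  ... | inj₂ k≤x = ≤-reflexive (shift-≥ k≤x)

  ≤-shift : ∀ x → x ≤ shift x
  ≤-shift x with <-≤-connex x k
  ... | inj₁ x<k = ≤-reflexive (sym (shift-< x<k))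
  ... | inj₂ k≤x = subst (x ≤_) (sym (shift-≥ k≤x)) (n≤1+n x)

  shift≢k : ∀ y → shift y ≢ k
  shift≢k y with <-≤-connex y k
  ... | inj₁ y<k = λ eq → <-irrefl (trans (sym (shift-< y<k)) eq) y<k
  ... | inj₂ k≤y = λ eq → <-irrefl (sym (trans (sym (shift-≥ k≤y)) eq)) (s≤s k≤y)

  shift-≤ : ∀ {y} → y ≤ m → shift y ≤ suc m
  shift-≤ {y} y≤m = ≤-trans (shift-≤-suc y) (s≤s y≤m)

  shift<N : ∀ {y} → InRange m y → shift y < N
  shift<N (_ , y≤m) = s≤s (shift-≤ y≤m)

  shift∈ : ∀ {y} → InRange m y → InRange N (shift y)
  shift∈ {y} (1≤y , y≤m) = ≤-trans 1≤y (≤-shift y) , m≤n⇒m≤1+n (shift-≤ y≤m)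

  k<N : k < N
  k<N = s≤s k≤1+m

  New : ℕ → Set
  New x = x ≡ k ⊎ x ≡ N

  data Position : ℕ → Set where
    new : ∀ {x} → New x → Position x
    old : ∀ {y} → InRange m y → Position (shift y)

  position : ∀ {x} → InRange N x → Position x
  position {x} (1≤x , x≤N) with <-cmp x k
  ... | tri< x<k _ _ = subst Position (shift-< x<k) (old (1≤x , ≤-pred (<-≤-trans x<k k≤1+m)))
  ... | tri≈ _ x≡k _ = new (inj₁ x≡k)
  position {suc y} (_ , 1+y≤N) | tri> _ _ k<1+y with m≤n⇒m<n∨m≡n 1+y≤N
  ... | inj₁ 1+y<N =
    subst Position (shift-≥ (≤-pred k<1+y)) (old (≤-trans 1≤k (≤-pred k<1+y) , ≤-pred (≤-pred 1+y<N)))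
  ... | inj₂ 1+y≡N = new (inj₂ 1+y≡N)

  new-below-N : ∀ {x} → New x → x < N → x ≡ k
  new-below-N (inj₁ x≡k) _ = x≡k
  new-below-N (inj₂ refl) x<N = contradiction x<N (<-irrefl refl)

  isNew : ℕ → Bool
  isNew x = (x ≡ᵇ k) ∨ (x ≡ᵇ N)

  isNew-new : ∀ {x} → New x → isNew x ≡ true
  isNew-new {x} (inj₁ x≡k) = cong (_∨ (x ≡ᵇ N)) (≡⇒≡ᵇ≡true x≡k)
  isNew-new {x} (inj₂ x≡N) = trans (cong ((x ≡ᵇ k) ∨_) (≡⇒≡ᵇ≡true x≡N)) (∨-zeroʳ (x ≡ᵇ k))

  isNew-shift : ∀ {y} → InRange m y → isNew (shift y) ≡ false
  isNew-shift {y} y∈ = cong₂ _∨_ (≢⇒≡ᵇ≡false (shift≢k y)) (≢⇒≡ᵇ≡false (<⇒≢ (shift<N y∈)))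

  ¬New-shift : ∀ {y} → InRange m y → ¬ New (shift y)
  ¬New-shift {y} _  (inj₁ sy≡k) = shift≢k y sy≡k
  ¬New-shift {y} y∈ (inj₂ sy≡N) = <⇒≢ (shift<N y∈) sy≡N

  -- `isNew` and `unshift` are the local definitions of `augmentation`, so that
  -- `augmentation N k σ a b` unfolds to `combine (isNew a) (isNew b) (σ (unshift a) (unshift b))`.
  combine : Bool → Bool → Bool → Bool
  combine p q r = if p ∧ q then true else if p ∨ q then false else r

  module _ (σ : BRel) where

    augmentation-new-new : ∀ {a b} → New a → New b → augmentation N k σ a b ≡ true
    augmentation-new-new {a} {b} na nb =
      cong₂ (λ p q → combine p q (σ (unshift a) (unshift b))) (isNew-new na) (isNew-new nb)

    augmentation-new-old : ∀ {a y} → New a → InRange m y → augmentation N k σ a (shift y) ≡ false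
    augmentation-new-old {a} {y} na y∈ =
      cong₂ (λ p q → combine p q (σ (unshift a) (unshift (shift y)))) (isNew-new na) (isNew-shift y∈)

    augmentation-old-new : ∀ {y b} → InRange m y → New b → augmentation N k σ (shift y) b ≡ false
    augmentation-old-new {y} {b} y∈ nb =
      cong₂ (λ p q → combine p q (σ (unshift (shift y)) (unshift b))) (isNew-shift y∈) (isNew-new nb)

    augmentation-old-old : ∀ {y y′} → InRange m y → InRange m y′ →
                           augmentation N k σ (shift y) (shift y′) ≡ σ y y′
    augmentation-old-old {y} {y′} y∈ y′∈ = begin
      augmentation N k σ (shift y) (shift y′)
        ≡⟨ cong₂ (λ p q → combine p q (σ (unshift (shift y)) (unshift (shift y′))))
                 (isNew-shift y∈) (isNew-shift y′∈) ⟩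
      σ (unshift (shift y)) (unshift (shift y′))
        ≡⟨ cong₂ σ (unshift-shift y) (unshift-shift y′) ⟩
      σ y y′ ∎
      where open ≡-Reasoning

    augmentation-IsPartition : IsPartition m σ → IsPartition N (augmentation N k σ)
    augmentation-IsPartition P = rfl , sym′ , trans′
      where
      open Partition P
      rfl : ∀ i → InRange N i → augmentation N k σ i i ≡ true
      rfl i i∈ with position i∈
      ... | new ni = augmentation-new-new ni ni
      ... | old y∈ = trans (augmentation-old-old y∈ y∈) (~-refl y∈)
      sym′ : ∀ i j → InRange N i → InRange N j → augmentation N k σ i j ≡ augmentation N k σ j i
      sym′ i j i∈ j∈ with position i∈ | position j∈
      ... | new ni | new nj = trans (augmentation-new-new ni nj) (sym (augmentation-new-new nj ni))
      ... | new ni | old y∈ = trans (augmentation-new-old ni y∈) (sym (augmentation-old-new y∈ ni))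
      ... | old y∈ | new nj = trans (augmentation-old-new y∈ nj) (sym (augmentation-new-old nj y∈))
      ... | old y∈ | old y′∈ =
        trans (augmentation-old-old y∈ y′∈) (trans (R-sym y∈ y′∈) (sym (augmentation-old-old y′∈ y∈)))
      trans′ : ∀ i j l → InRange N i → InRange N j → InRange N l →
               augmentation N k σ i j ≡ true → augmentation N k σ j l ≡ true → augmentation N k σ i l ≡ true
      trans′ i j l i∈ j∈ l∈ i~j j~l with position i∈ | position j∈ | position l∈
      ... | new ni | new nj | new nl = augmentation-new-new ni nl
      ... | new ni | new nj | old z∈ = contradiction (augmentation-new-old nj z∈) (not-¬ j~l)
      ... | new ni | old y∈ | _      = contradiction (augmentation-new-old ni y∈) (not-¬ i~j)
      ... | old x∈ | new nj | _      = contradiction (augmentation-old-new x∈ nj) (not-¬ i~j)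
      ... | old x∈ | old y∈ | new nl = contradiction (augmentation-old-new y∈ nl) (not-¬ j~l)
      ... | old x∈ | old y∈ | old z∈ = trans (augmentation-old-old x∈ z∈)
        (~-trans x∈ y∈ z∈ (trans (sym (augmentation-old-old x∈ y∈)) i~j)
                          (trans (sym (augmentation-old-old y∈ z∈)) j~l))

    augmentation-NoSingletons : NoSingletons m σ → NoSingletons N (augmentation N k σ)
    augmentation-NoSingletons ns i i∈ with position i∈
    ... | new (inj₁ refl) = N , (s≤s z≤n , ≤-refl) , (λ N≡k → <-irrefl (sym N≡k) k<N) ,
                            augmentation-new-new (inj₁ refl) (inj₂ refl)
    ... | new (inj₂ refl) = k , (1≤k , <⇒≤ k<N) , <⇒≢ k<N , augmentation-new-new (inj₂ refl) (inj₁ refl)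
    ... | old y∈ with ns _ y∈
    ...   | y′ , y′∈ , y′≢y , y~y′ =
      shift y′ , shift∈ y′∈ , y′≢y ∘ shift-injective , trans (augmentation-old-old y∈ y′∈) y~y′

    no-arc-under-new-block : AugmentationPoint m σ k → ∀ {b c} → InRange N b → InRange N c →
                             k < b → b < c → c < N → augmentation N k σ b c ≡ false
    no-arc-under-new-block (inj₂ refl) _ _ k<b b<c c<N = contradiction k<b (<⇒≱ (<-trans b<c c<N))
    no-arc-under-new-block (inj₁ (_ , _ , cap)) b∈ c∈ k<b b<c c<N with position b∈ | position c∈
    ... | new nb | _ = contradiction (new-below-N nb (<-trans b<c c<N)) (>⇒≢ k<b)
    ... | old _ | new nc = contradiction (new-below-N nc c<N) (>⇒≢ (<-trans k<b b<c))
    ... | old y∈ | old y′∈ = trans (augmentation-old-old y∈ y′∈)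
          (cap _ _ (k<shift⇒k≤ k<b) (proj₂ y∈) (shift-cancel-< b<c) (proj₂ y′∈))

    ¬Nesting-augmentation : AugmentationPoint m σ k → ¬ Nesting m σ → ¬ Nesting N (augmentation N k σ)
    ¬Nesting-augmentation point ¬ν ν@(nesting _ a<b b<c c<d d≤N a~d b~c a≁b)
      with position (Nesting.a∈ ν) | position (Nesting.d∈ ν)
    ... | new na | new _ = contradiction b~c (not-¬ (no-arc-under-new-block point (Nesting.b∈ ν) (Nesting.c∈ ν)
          (subst (_< _) (new-below-N na (Nesting.a<n ν)) a<b) b<c (Nesting.c<n ν)))
    ... | new na | old w∈ = contradiction (augmentation-new-old na w∈) (not-¬ a~d)
    ... | old x∈ | new nd = contradiction (augmentation-old-new x∈ nd) (not-¬ a~d)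
    ... | old x∈ | old w∈ with position (Nesting.b∈ ν) | position (Nesting.c∈ ν)
    ...   | new nb | new nc =
      <-irrefl (trans (new-below-N nb (Nesting.b<n ν)) (sym (new-below-N nc (Nesting.c<n ν)))) b<c
    ...   | new nb | old z∈ = contradiction (augmentation-new-old nb z∈) (not-¬ b~c)
    ...   | old y∈ | new nc = contradiction (augmentation-old-new y∈ nc) (not-¬ b~c)
    ...   | old y∈ | old z∈ =
      ¬ν (nesting (proj₁ x∈) (shift-cancel-< a<b) (shift-cancel-< b<c) (shift-cancel-< c<d) (proj₂ w∈)
          (trans (sym (augmentation-old-old x∈ w∈)) a~d) (trans (sym (augmentation-old-old y∈ z∈)) b~c)
          (trans (sym (augmentation-old-old x∈ y∈)) a≁b))

    augmentation-NestFree : AugmentationPoint m σ k → NestFree m σ → NestFree N (augmentation N k σ)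
    augmentation-NestFree point (P , ¬ν , ns) =
      augmentation-IsPartition P , ¬Nesting-augmentation point ¬ν , augmentation-NoSingletons ns

  augmentation-resp-≐ : ∀ {σ S} → σ ≐[ m ] S → augmentation N k σ ≐[ N ] augmentation N k S
  augmentation-resp-≐ {σ} {S} σ≐S i j i∈ j∈ with position i∈ | position j∈
  ... | new ni | new nj = trans (augmentation-new-new σ ni nj) (sym (augmentation-new-new S ni nj))
  ... | new ni | old y∈ = trans (augmentation-new-old σ ni y∈) (sym (augmentation-new-old S ni y∈))
  ... | old x∈ | new nj = trans (augmentation-old-new σ x∈ nj) (sym (augmentation-old-new S x∈ nj))
  ... | old x∈ | old y∈ =
    trans (augmentation-old-old σ x∈ y∈) (trans (σ≐S _ _ x∈ y∈) (sym (augmentation-old-old S x∈ y∈)))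

AugmentationPoint-range : ∀ {m σ k} → AugmentationPoint m σ k → 1 ≤ k × k ≤ suc m
AugmentationPoint-range (inj₁ (1≤k , k≤m , _)) = 1≤k , m≤n⇒m≤1+n k≤m
AugmentationPoint-range (inj₂ refl) = s≤s z≤n , ≤-refl

NestFree-base : NestFree 2 (λ _ _ → true)
NestFree-base =
  ((λ _ _ → refl) , (λ _ _ _ _ → refl) , (λ _ _ _ _ _ _ _ _ → refl)) , (λ { (nesting _ _ _ _ _ _ _ ()) }) , ns
  where
  ns : NoSingletons 2 (λ _ _ → true)
  ns 1 _ = 2 , (s≤s z≤n , ≤-refl) , (λ ()) , refl
  ns 2 _ = 1 , (s≤s z≤n , s≤s z≤n) , (λ ()) , refl
  ns 0 (() , _)
  ns (suc (suc (suc _))) (_ , s≤s (s≤s ()))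

Star⇒NestFree : ∀ {n R} → Star n R → NestFree n R
Star⇒NestFree base = NestFree-base
Star⇒NestFree (ins {m} star) = Insertion.insertion-NestFree m (Star⇒NestFree star)
Star⇒NestFree (aug {m} {σ} k star _ point) with AugmentationPoint-range point
... | 1≤k , k≤1+m = Augmentation.augmentation-NestFree m k 1≤k k≤1+m σ point (Star⇒NestFree star)

record LastBelow (P : ℕ → Bool) (t : ℕ) : Set where
  constructor lastBelow
  field
    last : ℕ
    1≤last : 1 ≤ last
    last<t : last < t
    P-last : P last ≡ true
    P-above : ∀ j → last < j → j < t → P j ≡ false

false-below-suc : ∀ {P : ℕ → Bool} {t j} → P t ≡ false → (j < t → P j ≡ false) →
                  j < suc t → P j ≡ false
false-below-suc Pt below j<1+t with m≤n⇒m<n∨m≡n (≤-pred j<1+t)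
... | inj₁ j<t = below j<t
... | inj₂ refl = Pt

lastBelow? : ∀ (P : ℕ → Bool) t → LastBelow P t ⊎ (∀ j → 1 ≤ j → j < t → P j ≡ false)
lastBelow? P zero = inj₂ λ _ _ ()
lastBelow? P (suc zero) = inj₂ λ { j 1≤j (s≤s j≤0) → contradiction j≤0 (<⇒≱ 1≤j) }
lastBelow? P (suc t@(suc _)) with P t in Pt | lastBelow? P t
... | true | _ = inj₁ (lastBelow t (s≤s z≤n) ≤-refl Pt λ j t<j j<1+t → contradiction t<j (<⇒≱ j<1+t))
... | false | inj₁ (lastBelow k 1≤k k<t Pk above) =
  inj₁ (lastBelow k 1≤k (m<n⇒m<1+n k<t) Pk λ j k<j → false-below-suc {P} Pt (above j k<j))
... | false | inj₂ none = inj₂ λ j 1≤j → false-below-suc {P} Pt (none j 1≤j)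

data Decomposition (m : ℕ) (R : BRel) : Set where
  via-insertion : NestFree (suc m) R → R ≐[ suc (suc m) ] insertion (suc (suc m)) R → Decomposition m R
  via-augmentation : ∀ k σ → AugmentationPoint m σ k → NestFree m σ →
                     R ≐[ suc (suc m) ] augmentation (suc (suc m)) k σ → Decomposition m R

module Decompose (m : ℕ) {R : BRel} (nf : NestFree (suc (suc m)) R) where

  N : ℕ
  N = suc (suc m)

  P : IsPartition N R
  P = proj₁ nf

  ¬ν : ¬ Nesting N R
  ¬ν = proj₁ (proj₂ nf)

  ns : NoSingletons N R
  ns = proj₂ (proj₂ nf)

  open Partition P

  N∈ : InRange N N
  N∈ = s≤s z≤n , ≤-refl

  1+m∈ : InRange N (suc m)
  1+m∈ = s≤s z≤n , n≤1+n _

  last-partner-is-predecessor : ∀ {a k} → 1 ≤ a → a < k → k < N → R a N ≡ true → R k N ≡ true →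
                                (∀ j → k < j → j < N → R j N ≡ false) → k ≡ suc m
  last-partner-is-predecessor {a} {k} 1≤a a<k k<N a~N k~N above with m≤n⇒m<n∨m≡n (≤-pred k<N)
  ... | inj₂ k≡1+m = k≡1+m
  ... | inj₁ k<1+m with ns (suc m) 1+m∈
  ...   | j , j∈@(1≤j , j≤N) , j≢1+m , 1+m~j = ⊥-elim (nested (<-cmp j k))
    where
    1≤k : 1 ≤ k
    1≤k = ≤-trans 1≤a (<⇒≤ a<k)
    a∈ : InRange N a
    a∈ = 1≤a , <⇒≤ (<-trans a<k k<N)
    k∈ : InRange N k
    k∈ = 1≤k , <⇒≤ k<N
    1+m≁N : R (suc m) N ≡ false
    1+m≁N = above (suc m) k<1+m ≤-refl
    j~1+m : R j (suc m) ≡ true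
    j~1+m = ~-sym 1+m∈ j∈ 1+m~j
    j≁N : R j N ≡ false
    j≁N = ~-≁-trans j∈ 1+m∈ N∈ j~1+m 1+m≁N
    j<1+m : j < suc m
    j<1+m = ≤∧≢⇒< (≤-pred (≤∧≢⇒< j≤N λ { refl → not-¬ 1+m~j 1+m≁N })) j≢1+m
    nested : Tri (j < k) (j ≡ k) (k < j) → ⊥
    nested (tri< j<k _ _) with <-cmp j a
    ... | tri< j<a _ _ = ¬ν (nesting 1≤j j<a a<k k<1+m (n≤1+n _) j~1+m
            (~-trans a∈ N∈ k∈ a~N (~-sym k∈ N∈ k~N)) (≁-~-trans j∈ N∈ a∈ j≁N (~-sym a∈ N∈ a~N)))
    ... | tri≈ _ refl _ = not-¬ a~N j≁N
    ... | tri> _ _ a<j = ¬ν (nesting 1≤a a<j j<1+m ≤-refl ≤-refl a~N j~1+m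
            (~-≁-trans a∈ N∈ j∈ a~N (≁-sym j∈ N∈ j≁N)))
    nested (tri≈ _ refl _) = not-¬ k~N j≁N
    nested (tri> _ _ k<j) = ¬ν (nesting 1≤k k<j j<1+m ≤-refl ≤-refl k~N j~1+m
            (~-≁-trans k∈ N∈ j∈ k~N (≁-sym j∈ N∈ j≁N)))

  insertion-case : ∀ {a} → 1 ≤ a → a < suc m → R a N ≡ true → R (suc m) N ≡ true →
                   NestFree (suc m) R × R ≐[ N ] insertion N R
  insertion-case {a} 1≤a a<1+m a~N 1+m~N =
    (IsPartition-on (λ x → x) ∈N P , ¬ν ∘ Nesting-on (λ x → x) ∈N (λ i<j → i<j) , ns′) , R≐
    where
    open Insertion m using (clamp; clamp-≤; clamp-N; clamp∈)
    ∈N : ∀ {x} → InRange (suc m) x → InRange N x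
    ∈N = InRange-≤ (n≤1+n _)
    a∈′ : InRange (suc m) a
    a∈′ = 1≤a , <⇒≤ a<1+m
    a∈ : InRange N a
    a∈ = ∈N a∈′
    ns′ : NoSingletons (suc m) R
    ns′ i i∈ with ns i (∈N i∈)
    ... | j , (1≤j , j≤N) , j≢i , i~j with m≤n⇒m<n∨m≡n j≤N
    ...   | inj₁ j<N = j , (1≤j , ≤-pred j<N) , j≢i , i~j
    ...   | inj₂ refl with i ≟ suc m
    ...     | yes refl = a , a∈′ , <⇒≢ a<1+m , ~-trans 1+m∈ N∈ a∈ 1+m~N (~-sym a∈ N∈ a~N)
    ...     | no i≢1+m = suc m , (s≤s z≤n , ≤-refl) , i≢1+m ∘ sym ,
                         ~-trans (∈N i∈) N∈ 1+m∈ i~j (~-sym 1+m∈ N∈ 1+m~N)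
    ~clamp : ∀ {x} → InRange N x → R x (clamp x) ≡ true
    ~clamp {x} x∈@(_ , x≤N) with m≤n⇒m<n∨m≡n x≤N
    ... | inj₁ x<N = subst (λ y → R x y ≡ true) (sym (clamp-≤ (≤-pred x<N))) (~-refl x∈)
    ... | inj₂ refl = subst (λ y → R N y ≡ true) (sym clamp-N) (~-sym 1+m∈ N∈ 1+m~N)
    R≐ : R ≐[ N ] insertion N R
    R≐ i j i∈ j∈ = R-resp-~ i∈ (∈N (clamp∈ i∈)) j∈ (∈N (clamp∈ j∈)) (~clamp i∈) (~clamp j∈)

  module AugmentationCase {k} (1≤k : 1 ≤ k) (k<N : k < N) (k~N : R k N ≡ true)
                          (block : ∀ {x} → InRange N x → R x N ≡ true → x ≡ k ⊎ x ≡ N) where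

    open Augmentation m k 1≤k (≤-pred k<N) hiding (N; k<N)

    σ : BRel
    σ = R on shift

    k∈ : InRange N k
    k∈ = 1≤k , <⇒≤ k<N

    new~N : ∀ {x} → New x → R x N ≡ true
    new~N (inj₁ refl) = k~N
    new~N (inj₂ refl) = ~-refl N∈

    old≁N : ∀ {y} → InRange m y → R (shift y) N ≡ false
    old≁N y∈ = ≢true⇒≡false λ sy~N → ¬New-shift y∈ (block (shift∈ y∈) sy~N)

    σ-NoSingletons : NoSingletons m σ
    σ-NoSingletons y y∈ with ns (shift y) (shift∈ y∈)
    ... | j , j∈ , j≢sy , sy~j with position j∈
    ...   | new nj = ⊥-elim (not-¬ (~-trans (shift∈ y∈) j∈ N∈ sy~j (new~N nj)) (old≁N y∈))
    ...   | old y′∈ = _ , y′∈ , (λ y′≡y → j≢sy (cong shift y′≡y)) , sy~j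

    σ-NestFree : NestFree m σ
    σ-NestFree = IsPartition-on shift shift∈ P , ¬ν ∘ Nesting-on shift shift∈ shift-mono-< , σ-NoSingletons

    point : AugmentationPoint m σ k
    point with k ≟ suc m
    ... | yes k≡1+m = inj₂ k≡1+m
    ... | no k≢1+m = inj₁ (1≤k , k≤m , cap)
      where
      k≤m : k ≤ m
      k≤m = ≤-pred (≤∧≢⇒< (≤-pred k<N) k≢1+m)
      cap : IsCap m σ k
      cap i j k≤i i≤m i<j j≤m = ≢true⇒≡false λ σij →
        ¬ν (nesting 1≤k k<si (shift-mono-< i<j) (shift<N j∈) ≤-refl k~N σij k≁si)
        where
        i∈ : InRange m i
        i∈ = ≤-trans 1≤k k≤i , i≤m
        j∈ : InRange m j
        j∈ = ≤-trans 1≤k (≤-trans k≤i (<⇒≤ i<j)) , j≤m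
        k<si : k < shift i
        k<si = subst (k <_) (sym (shift-≥ k≤i)) (s≤s k≤i)
        k≁si : R k (shift i) ≡ false
        k≁si = ~-≁-trans k∈ N∈ (shift∈ i∈) k~N (≁-sym (shift∈ i∈) N∈ (old≁N i∈))

    R≐ : R ≐[ N ] augmentation N k σ
    R≐ i j i∈ j∈ with position i∈ | position j∈
    ... | new ni | new nj =
      trans (~-trans i∈ N∈ j∈ (new~N ni) (~-sym j∈ N∈ (new~N nj))) (sym (augmentation-new-new σ ni nj))
    ... | new ni | old y∈ =
      trans (~-≁-trans i∈ N∈ j∈ (new~N ni) (≁-sym j∈ N∈ (old≁N y∈))) (sym (augmentation-new-old σ ni y∈))
    ... | old x∈ | new nj =
      trans (≁-~-trans i∈ N∈ j∈ (old≁N x∈) (~-sym j∈ N∈ (new~N nj))) (sym (augmentation-old-new σ x∈ nj))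
    ... | old x∈ | old y∈ = sym (augmentation-old-old σ x∈ y∈)

    decomposition : Decomposition m R
    decomposition = via-augmentation k σ point σ-NestFree R≐

  decompose : Decomposition m R
  decompose with lastBelow? (λ j → R j N) N
  ... | inj₂ none with ns N N∈
  ...   | j , j∈@(1≤j , j≤N) , j≢N , N~j =
    ⊥-elim (not-¬ (~-sym N∈ j∈ N~j) (none j 1≤j (≤∧≢⇒< j≤N j≢N)))
  decompose | inj₁ (lastBelow k 1≤k k<N k~N above) with lastBelow? (λ j → R j N) k
  ... | inj₁ (lastBelow a 1≤a a<k a~N _) with last-partner-is-predecessor 1≤a a<k k<N a~N k~N above
  ...   | refl = uncurry via-insertion (insertion-case 1≤a a<k a~N k~N)
  decompose | inj₁ (lastBelow k 1≤k k<N k~N above) | inj₂ none-below =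
    AugmentationCase.decomposition 1≤k k<N k~N block
    where
    block : ∀ {x} → InRange N x → R x N ≡ true → x ≡ k ⊎ x ≡ N
    block {x} (1≤x , x≤N) x~N with <-cmp x k | m≤n⇒m<n∨m≡n x≤N
    ... | tri< x<k _ _ | _ = contradiction (none-below x 1≤x x<k) (not-¬ x~N)
    ... | tri≈ _ x≡k _ | _ = inj₁ x≡k
    ... | tri> _ _ k<x | inj₁ x<N = contradiction (above x k<x x<N) (not-¬ x~N)
    ... | tri> _ _ _ | inj₂ x≡N = inj₂ x≡N

AugmentationPoint-resp-≐ : ∀ {m σ S k} → σ ≐[ m ] S → AugmentationPoint m σ k → AugmentationPoint m S k
AugmentationPoint-resp-≐ {m} {S = S} {k} σ≐S (inj₁ (1≤k , k≤m , cap)) = inj₁ (1≤k , k≤m , cap′)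
  where
  cap′ : IsCap m S k
  cap′ = λ i j k≤i i≤m i<j j≤m → trans (sym (σ≐S i j (≤-trans 1≤k k≤i , i≤m)
           (≤-trans 1≤k (≤-trans k≤i (<⇒≤ i<j)) , j≤m))) (cap i j k≤i i≤m i<j j≤m)
AugmentationPoint-resp-≐ _ (inj₂ k≡1+m) = inj₂ k≡1+m

InStar-insertion : ∀ {m π} → InStar (suc m) π → InStar (suc (suc m)) (insertion (suc (suc m)) π)
InStar-insertion {m} (S , star , π≐S) = insertion (suc (suc m)) S , ins star , Insertion.insertion-resp-≐ m π≐S

InStar-augmentation : ∀ {m σ k} → 2 ≤ m → AugmentationPoint m σ k → InStar m σ →
                      InStar (suc (suc m)) (augmentation (suc (suc m)) k σ)
InStar-augmentation {m} {k = k} 2≤m point (S , star , σ≐S) with AugmentationPoint-range point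
... | 1≤k , k≤1+m = augmentation (suc (suc m)) k S , aug k star 2≤m (AugmentationPoint-resp-≐ σ≐S point) ,
                    Augmentation.augmentation-resp-≐ m k 1≤k k≤1+m σ≐S

NoSingletons⇒2≤ : ∀ {m R} → NoSingletons (suc m) R → 2 ≤ suc m
NoSingletons⇒2≤ {zero} ns with ns 1 (s≤s z≤n , s≤s z≤n)
... | j , (1≤j , j≤1) , j≢1 , _ = contradiction (≤-antisym j≤1 1≤j) j≢1
NoSingletons⇒2≤ {suc _} _ = s≤s (s≤s z≤n)

NestFree₂⇒InStar : ∀ {R} → NestFree 2 R → InStar 2 R
NestFree₂⇒InStar {R} (P , _ , ns) = (λ _ _ → true) , base , R≐
  where
  open Partition P
  1∈ : InRange 2 1
  1∈ = s≤s z≤n , s≤s z≤n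
  2∈ : InRange 2 2
  2∈ = s≤s z≤n , ≤-refl
  1~2 : R 1 2 ≡ true
  1~2 with ns 1 1∈
  ... | 2 , _ , _ , 1~j = 1~j
  ... | 1 , _ , 1≢1 , _ = contradiction refl 1≢1
  ... | 0 , (() , _) , _
  ... | suc (suc (suc _)) , (_ , s≤s (s≤s ())) , _
  ~1 : ∀ {i} → InRange 2 i → R i 1 ≡ true
  ~1 {1} _ = ~-refl 1∈
  ~1 {2} _ = ~-sym 1∈ 2∈ 1~2
  ~1 {0} (() , _)
  ~1 {suc (suc (suc _))} (_ , s≤s (s≤s ()))
  R≐ : R ≐[ 2 ] (λ _ _ → true)
  R≐ i j i∈ j∈ = ~-trans i∈ 1∈ j∈ (~1 i∈) (~-sym j∈ 1∈ (~1 j∈))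

InStar-step : ∀ m {R} → (∀ {π} → NestFree (suc (suc m)) π → InStar (suc (suc m)) π) →
              (∀ {σ} → 2 ≤ suc m → NestFree (suc m) σ → InStar (suc m) σ) →
              NestFree (suc (suc (suc m))) R → InStar (suc (suc (suc m))) R
InStar-step m IH₁ IH₂ nf with Decompose.decompose (suc m) nf
... | via-insertion nf′ R≐ = InStar-resp-≐ R≐ (InStar-insertion (IH₁ nf′))
... | via-augmentation k σ point nfσ R≐ = InStar-resp-≐ R≐ (InStar-augmentation 2≤1+m point (IH₂ 2≤1+m nfσ))
  where
  2≤1+m : 2 ≤ suc m
  2≤1+m = NoSingletons⇒2≤ (proj₂ (proj₂ nfσ))

NestFree⇒InStar : ∀ n {R} → 2 ≤ n → NestFree n R → InStar n R
NestFree⇒InStar 1 (s≤s ())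
NestFree⇒InStar 2 _ = NestFree₂⇒InStar
NestFree⇒InStar (suc (suc (suc m))) _ =
  InStar-step m (NestFree⇒InStar (suc (suc m)) (s≤s (s≤s z≤n))) (NestFree⇒InStar (suc m))

lemma4p9 : (n : ℕ) → 2 ≤ n → (R : BRel) → InStar n R ⇔ InAvoidStar n R
lemma4p9 n 2≤n R = mk⇔
  (λ (S , star , R≐S) → Equivalence.to NestFree⇔InAvoidStar (NestFree-resp-≐ R≐S (Star⇒NestFree star)))
  (λ avoids → NestFree⇒InStar n 2≤n (Equivalence.from NestFree⇔InAvoidStar avoids))
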